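{- Let $G$ be a connected bipartite $(p,q)$-graph with vertex bipartition $(X,Y)$, and let $f:V(G)\to\{0,1,2,\dots\}$, extended to edges by $f(xy)=|f(x)-f(y)|$. Define $g_{setXY}(x)=\max f(X)+\min f(X)-f(x)$ for $x\in X$, $g_{setXY}(y)=\max f(Y)+\min f(Y)-f(y)$ for $y\in Y$, and $g_{setXY}(xy)=|g_{setXY}(x)-g_{setXY}(y)|$ for $xy\in E(G)$. Define the total map $g^*_{setXY}$ by $g^*_{setXY}(w)=g_{setXY}(w)$ for $w\in V(G)$ and $g^*_{setXY}(xy)=\max f(E(G))+\min f(E(G))-f(xy)$ for $xy\in E(G)$. Then $f$ is a set-ordered graceful labeling of $G$ if and only if $g_{setXY}$ is a set-ordered graceful labeling of $G$ and $g^*_{setXY}$ is a set-ordered graceful-difference total labeling of $G$.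
   Context: A $(p,q)$-graph has $p$ vertices and $q$ edges; $[a,b]=\{a,\dots,b\}$; $\theta(S)=\{\theta(s):s\in S\}$. With respect to the bipartition $(X,Y)$, a map $\theta$ is set-ordered if $\max\theta(X)<\min\theta(Y)$. A set-ordered graceful labeling is an injective map $f:V(G)\to\{0,1,\dots\}$ with $f(V(G))\subseteq[0,q]$, $\min f(V(G))=0$, $\{|f(x)-f(y)|:xy\in E(G)\}=[1,q]$, and $\max f(X)<\min f(Y)$. A set-ordered graceful-difference total labeling of $G$ is a map $g:V(G)\cup E(G)\to\mathbb{Z}$ that is injective on $V(G)$, satisfies $\max g(X)<\min g(Y)$, and for which there is a non-negative integer $k$ with $\big||g(x)-g(y)|-g(xy)\big|=k$ for every edge $xy\in E(G)$. -}

module Defs where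

open import Data.Nat as ℕ using (ℕ; _+_; _∸_; _≤_; _<_; _⊔_; _⊓_)
open import Data.Integer as ℤ using (ℤ; +_)
open import Data.Fin using (Fin)
open import Data.List using (List; []; _∷_; map; filter; foldr; allFin)
open import Data.Bool using (Bool; true; false)
import Data.Bool.Properties as BoolP
open import Data.Product using (Σ; ∃; ∃-syntax; _×_; _,_; proj₁; proj₂)
open import Data.Sum using (_⊎_)
open import Relation.Binary.PropositionalEquality using (_≡_)
open import Relation.Binary.Construct.Closure.ReflexiveTransitive using (Star)
open import Function.Definitions using (Injective)

-- Vertices: Fin p.  side v ≡ true means v ∈ X, side v ≡ false means v ∈ Y.
-- Edges: Fin q; edge e is the edge x y with ends e = (x , y), x ∈ X, y ∈ Y.
record BipGraph (p q : ℕ) : Set where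
  field
    side   : Fin p → Bool
    ends   : Fin q → Fin p × Fin p
    endX   : ∀ e → side (proj₁ (ends e)) ≡ true
    endY   : ∀ e → side (proj₂ (ends e)) ≡ false
    simple : Injective _≡_ _≡_ ends

module _ {p q : ℕ} (G : BipGraph p q) where
  open BipGraph G

  Adj : Fin p → Fin p → Set
  Adj u v = ∃[ e ] (ends e ≡ (u , v) ⊎ ends e ≡ (v , u))

  Connected : Set
  Connected = ∀ u v → Star Adj u v

  xe : Fin q → Fin p
  xe e = proj₁ (ends e)

  ye : Fin q → Fin p
  ye e = proj₂ (ends e)

maxL : List ℕ → ℕ
maxL = foldr _⊔_ 0

minL : List ℕ → ℕ
minL []       = 0
minL (x ∷ xs) = foldr _⊓_ x xs

module _ {p q : ℕ} (G : BipGraph p q) where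
  open BipGraph G

  valsX : (Fin p → ℕ) → List ℕ
  valsX θ = map θ (filter (λ v → side v BoolP.≟ true) (allFin p))

  valsY : (Fin p → ℕ) → List ℕ
  valsY θ = map θ (filter (λ v → side v BoolP.≟ false) (allFin p))

  edgeLab : (Fin p → ℕ) → Fin q → ℕ
  edgeLab f e = ℕ.∣ f (xe G e) - f (ye G e) ∣

  valsE : (Fin p → ℕ) → List ℕ
  valsE f = map (edgeLab f) (allFin q)

  IsSOGraceful : (Fin p → ℕ) → Set
  IsSOGraceful f =
      Injective _≡_ _≡_ f
    × (∀ v → f v ≤ q)
    × (∃[ v ] f v ≡ 0)
    × (∀ e → 1 ≤ edgeLab f e × edgeLab f e ≤ q)
    × (∀ k → 1 ≤ k → k ≤ q → ∃[ e ] edgeLab f e ≡ k)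
    × (maxL (valsX f) < minL (valsY f))

  IsSOGDTL : (Fin p → ℤ) → (Fin q → ℤ) → Set
  IsSOGDTL gv ge =
      Injective _≡_ _≡_ gv
    × (∀ x y → side x ≡ true → side y ≡ false → gv x ℤ.< gv y)
    × (∃[ k ] ∀ e → ℤ.∣ (+ ℤ.∣ gv (xe G e) ℤ.- gv (ye G e) ∣) ℤ.- ge e ∣ ≡ k)

  gSet : (Fin p → ℕ) → Fin p → ℕ
  gSet f v with side v
  ... | true  = maxL (valsX f) + minL (valsX f) ∸ f v
  ... | false = maxL (valsY f) + minL (valsY f) ∸ f v

  gStarV : (Fin p → ℕ) → Fin p → ℤ
  gStarV f v = + gSet f v

  gStarE : (Fin p → ℕ) → Fin q → ℤ
  gStarE f e = + (maxL (valsE f) + minL (valsE f)) ℤ.- + edgeLab f e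

{-# OPTIONS --safe #-}
-- On each side of the bipartition, g_setXY is the reflection x ↦ max + min − x of
-- that side's labels; it swaps the extreme labels of the side, so it keeps the
-- extremes themselves and is an involution. For a set-ordered graceful f the
-- extremes are 0 and A on X and A + 1 and q on Y, hence g(y) − g(x) = q + 1 − f(xy)
-- on every edge: g is again set-ordered graceful, and since max f(E) + min f(E) = q + 1
-- this difference is exactly g*(xy), so g* is graceful-difference with k = 0.
-- Conversely, applying this to g returns g_setXY(g) = f.
module Submission where

open import Defs
open import Data.Nat using (ℕ; _≤_)
open import Data.Fin using (Fin; fromℕ<)
open import Data.Product using (_×_; ∃-syntax; _,_; proj₁; proj₂)
open import Function.Bundles using (_⇔_; mk⇔)

open import Data.Nat as ℕ using (suc; _+_; _∸_; _<_; z≤n)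
open import Data.Nat.Properties
import Data.Integer as ℤ
import Data.Integer.Properties as ℤ
open import Data.Bool using (Bool; true; false)
import Data.Bool.Properties as Bool
open import Data.List using (List; []; _∷_; map; filter; allFin)
open import Data.List.Properties using (map-cong; foldr-preservesᵇ; foldr-preservesᵒ)
open import Data.List.Membership.Propositional using (_∈_)
open import Data.List.Membership.Propositional.Properties using (∈-map⁺; ∈-map⁻; ∈-filter⁺; ∈-filter⁻; ∈-allFin)
open import Data.List.Relation.Unary.Any as Any using (here; there)
open import Data.List.Relation.Unary.All as All using (All)
open import Data.List.Relation.Unary.All.Properties using (map⁺; tabulate⁺)
open import Data.Sum using (_⊎_; inj₁; inj₂; [_,_])
open import Function using (_∘_)
open import Function.Definitions using (Injective)
open import Relation.Binary.PropositionalEquality using (_≡_; refl; sym; trans; cong; cong₂; subst; subst₂; _≢_; ≢-sym; module ≡-Reasoning)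
open import Relation.Nullary using (contradiction; yes; no)
open import Algebra.Properties.CommutativeSemigroup +-commutativeSemigroup using (interchange)

selected-∈ : ∀ {a b c} {xs : List ℕ} → c ≡ a ⊎ c ≡ b → a ∈ xs → b ∈ xs → c ∈ xs
selected-∈ (inj₁ refl) a∈ _ = a∈
selected-∈ (inj₂ refl) _ b∈ = b∈

maxL-upper : ∀ {x xs} → x ∈ xs → x ≤ maxL xs
maxL-upper {xs = xs} x∈ =
  foldr-preservesᵒ (λ a b → [ m≤n⇒m≤n⊔o b , m≤n⇒m≤o⊔n a ]) 0 xs (inj₂ (Any.map ≤-reflexive x∈))

maxL-least : ∀ {M xs} → All (_≤ M) xs → maxL xs ≤ M
maxL-least = foldr-preservesᵇ ⊔-lub z≤n

maxL-∈ : ∀ {x xs} → x ∈ xs → maxL xs ∈ xs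
maxL-∈ {xs = y ∷ []} _ = here (⊔-identityʳ y)
maxL-∈ {xs = y ∷ z ∷ zs} _ = selected-∈ (⊔-sel y _) (here refl) (there (maxL-∈ {xs = z ∷ zs} (here refl)))

maxL-unique : ∀ {M xs} → All (_≤ M) xs → M ∈ xs → maxL xs ≡ M
maxL-unique xs≤M M∈ = ≤-antisym (maxL-least xs≤M) (maxL-upper M∈)

minL-lower : ∀ {x xs} → x ∈ xs → minL xs ≤ x
minL-lower {xs = y ∷ ys} x∈ =
  foldr-preservesᵒ (λ a b → [ m≤n⇒m⊓o≤n b , m≤n⇒o⊓m≤n a ]) y ys (lower x∈)
  where
  lower : ∀ {x} → x ∈ y ∷ ys → y ≤ x ⊎ Any.Any (_≤ x) ys
  lower (here refl) = inj₁ ≤-refl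
  lower (there x∈ys) = inj₂ (Any.map (≤-reflexive ∘ sym) x∈ys)

minL-greatest : ∀ {M y ys} → All (M ≤_) (y ∷ ys) → M ≤ minL (y ∷ ys)
minL-greatest (M≤y All.∷ M≤ys) = foldr-preservesᵇ ⊓-glb M≤y M≤ys

minL-∈ : ∀ {x xs} → x ∈ xs → minL xs ∈ xs
minL-∈ {xs = y ∷ ys} _ =
  foldr-preservesᵇ (λ {a} {b} → selected-∈ (⊓-sel a b)) (here refl) (All.tabulate there)

minL-unique : ∀ {M xs} → All (M ≤_) xs → M ∈ xs → minL xs ≡ M
minL-unique {xs = _ ∷ _} M≤xs M∈ = ≤-antisym (minL-lower M∈) (minL-greatest M≤xs)

differences-sum : ∀ {a b c d} → a ≤ b → c ≤ d → (b ∸ a) + (d ∸ c) + (a + c) ≡ b + d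
differences-sum {a} {b} {c} {d} a≤b c≤d = begin
  (b ∸ a) + (d ∸ c) + (a + c)  ≡⟨ interchange (b ∸ a) (d ∸ c) a c ⟩
  (b ∸ a + a) + (d ∸ c + c)    ≡⟨ cong₂ _+_ (m∸n+n≡m a≤b) (m∸n+n≡m c≤d) ⟩
  b + d                        ∎
  where open ≡-Reasoning

reflect-[1,q] : ∀ {q k} → 1 ≤ k → k ≤ q → 1 ≤ suc q ∸ k × suc q ∸ k ≤ q
reflect-[1,q] {q} 1≤k k≤q = ≤-trans (≤-reflexive (sym (m+n∸n≡m 1 q))) (∸-monoʳ-≤ (suc q) k≤q)
                          , ∸-monoʳ-≤ (suc q) 1≤k

∣+m-+n∣≡n∸m : ∀ {m n} → m ≤ n → ℤ.∣ ℤ.+ m ℤ.- ℤ.+ n ∣ ≡ n ∸ m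
∣+m-+n∣≡n∸m {m} {n} m≤n = trans (cong ℤ.∣_∣ (ℤ.m-n≡m⊖n m n)) (ℤ.∣⊖∣-≤ m≤n)

+[m+n]-+n≡+m : ∀ m n → ℤ.+ (m + n) ℤ.- ℤ.+ n ≡ ℤ.+ m
+[m+n]-+n≡+m m n = trans (ℤ.m-n≡m⊖n (m + n) n)
                     (trans (ℤ.⊖-≥ (m≤n+m n m)) (cong ℤ.+_ (m+n∸n≡m m n)))

module _ {p q : ℕ} (G : BipGraph p q) where
  open BipGraph G

  onSide : Bool → List (Fin p)
  onSide b = filter (λ v → side v Bool.≟ b) (allFin p)

  ∈-onSide : ∀ {b v} → side v ≡ b → v ∈ onSide b
  ∈-onSide {b} {v} sv = ∈-filter⁺ (λ v → side v Bool.≟ b) (∈-allFin v) sv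

  ∈-onSide⁻ : ∀ {b v} → v ∈ onSide b → side v ≡ b
  ∈-onSide⁻ {b} v∈ = proj₂ (∈-filter⁻ (λ v → side v Bool.≟ b) {xs = allFin p} v∈)

  valsOn : Bool → (Fin p → ℕ) → List ℕ
  valsOn b h = map h (onSide b)

  maxOn minOn : Bool → (Fin p → ℕ) → ℕ
  maxOn b h = maxL (valsOn b h)
  minOn b h = minL (valsOn b h)

  SetOrdered : (Fin p → ℕ) → Set
  SetOrdered h = maxOn true h < minOn false h

  module _ {b : Bool} {h : Fin p → ℕ} where

    ∈-valsOn : ∀ {v} → side v ≡ b → h v ∈ valsOn b h
    ∈-valsOn = ∈-map⁺ h ∘ ∈-onSide

    ∈-valsOn⁻ : ∀ {x} → x ∈ valsOn b h → ∃[ v ] side v ≡ b × x ≡ h v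
    ∈-valsOn⁻ x∈ with ∈-map⁻ h x∈
    ... | v , v∈ , x≡hv = v , ∈-onSide⁻ v∈ , x≡hv

    All-valsOn : ∀ {P : ℕ → Set} → (∀ v → side v ≡ b → P (h v)) → All P (valsOn b h)
    All-valsOn Ph = map⁺ (All.tabulate (λ {v} v∈ → Ph v (∈-onSide⁻ v∈)))

    maxOn-upper : ∀ {v} → side v ≡ b → h v ≤ maxOn b h
    maxOn-upper = maxL-upper ∘ ∈-valsOn

    minOn-lower : ∀ {v} → side v ≡ b → minOn b h ≤ h v
    minOn-lower = minL-lower ∘ ∈-valsOn

    maxOn-attained : ∀ {v} → side v ≡ b → ∃[ w ] side w ≡ b × h w ≡ maxOn b h
    maxOn-attained sv with ∈-valsOn⁻ (maxL-∈ (∈-valsOn sv))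
    ... | w , sw , max≡hw = w , sw , sym max≡hw

    minOn-attained : ∀ {v} → side v ≡ b → ∃[ w ] side w ≡ b × h w ≡ minOn b h
    minOn-attained sv with ∈-valsOn⁻ (minL-∈ (∈-valsOn sv))
    ... | w , sw , min≡hw = w , sw , sym min≡hw

    maxOn-unique : ∀ {M v} → (∀ u → side u ≡ b → h u ≤ M) → side v ≡ b → h v ≡ M → maxOn b h ≡ M
    maxOn-unique h≤M sv hv≡M = maxL-unique (All-valsOn h≤M) (subst (_∈ valsOn b h) hv≡M (∈-valsOn sv))

    minOn-unique : ∀ {M v} → (∀ u → side u ≡ b → M ≤ h u) → side v ≡ b → h v ≡ M → minOn b h ≡ M
    minOn-unique M≤h sv hv≡M = minL-unique (All-valsOn M≤h) (subst (_∈ valsOn b h) hv≡M (∈-valsOn sv))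

  module _ {h : Fin p → ℕ} (ordered : SetOrdered h) where

    <-across : ∀ {x y} → side x ≡ true → side y ≡ false → h x < h y
    <-across sx sy = ≤-<-trans (maxOn-upper sx) (<-≤-trans ordered (minOn-lower sy))

    ≢-across : ∀ {u v} → side u ≢ side v → h u ≢ h v
    ≢-across {u} {v} su≢sv with side u in su | side v in sv
    ... | true  | true  = contradiction refl su≢sv
    ... | false | false = contradiction refl su≢sv
    ... | true  | false = <⇒≢ (<-across su sv)
    ... | false | true  = ≢-sym (<⇒≢ (<-across sv su))

    edgeLab≡∸ : ∀ e → edgeLab G h e ≡ h (ye G e) ∸ h (xe G e)
    edgeLab≡∸ e = m≤n⇒∣m-n∣≡n∸m (<⇒≤ (<-across (endX e) (endY e)))

  module _ {f : Fin p → ℕ} where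

    private
      g : Fin p → ℕ
      g = gSet G f

    gSet-onSide : ∀ {b v} → side v ≡ b → g v ≡ maxOn b f + minOn b f ∸ f v
    gSet-onSide {v = v} refl with side v
    ... | true  = refl
    ... | false = refl

    gSet-complement : ∀ {b v} → side v ≡ b → g v + f v ≡ maxOn b f + minOn b f
    gSet-complement {b} sv = trans (cong (_+ _) (gSet-onSide sv))
      (m∸n+n≡m (≤-trans (maxOn-upper sv) (m≤m+n (maxOn b f) (minOn b f))))

    gSet-upper : ∀ {b v} → side v ≡ b → g v ≤ maxOn b f
    gSet-upper {b} {v} sv = begin
      g v                                ≡⟨ gSet-onSide sv ⟩
      maxOn b f + minOn b f ∸ f v        ≤⟨ ∸-monoʳ-≤ (maxOn b f + minOn b f) (minOn-lower sv) ⟩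
      maxOn b f + minOn b f ∸ minOn b f  ≡⟨ m+n∸n≡m (maxOn b f) (minOn b f) ⟩
      maxOn b f                          ∎
      where open ≤-Reasoning

    gSet-lower : ∀ {b v} → side v ≡ b → minOn b f ≤ g v
    gSet-lower {b} {v} sv = begin
      minOn b f                          ≡⟨ m+n∸m≡n (maxOn b f) (minOn b f) ⟨
      maxOn b f + minOn b f ∸ maxOn b f  ≤⟨ ∸-monoʳ-≤ (maxOn b f + minOn b f) (maxOn-upper sv) ⟩
      maxOn b f + minOn b f ∸ f v        ≡⟨ gSet-onSide sv ⟨
      g v                                ∎
      where open ≤-Reasoning

    maxOn-gSet : ∀ {b v} → side v ≡ b → maxOn b g ≡ maxOn b f
    maxOn-gSet {b} sv with minOn-attained sv
    ... | w , sw , fw≡min = maxOn-unique (λ _ → gSet-upper) sw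
      (trans (gSet-onSide sw) (trans (cong (maxOn b f + minOn b f ∸_) fw≡min) (m+n∸n≡m (maxOn b f) (minOn b f))))

    minOn-gSet : ∀ {b v} → side v ≡ b → minOn b g ≡ minOn b f
    minOn-gSet {b} sv with maxOn-attained sv
    ... | w , sw , fw≡max = minOn-unique (λ _ → gSet-lower) sw
      (trans (gSet-onSide sw) (trans (cong (maxOn b f + minOn b f ∸_) fw≡max) (m+n∸m≡n (maxOn b f) (minOn b f))))

    gSet-setOrdered : ∀ {x y} → side x ≡ true → side y ≡ false → SetOrdered f → SetOrdered g
    gSet-setOrdered sx sy = subst₂ _<_ (sym (maxOn-gSet sx)) (sym (minOn-gSet sy))

    gSet-injective-onSide : Injective _≡_ _≡_ f → ∀ {b u v} → side u ≡ b → side v ≡ b → g u ≡ g v → u ≡ v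
    gSet-injective-onSide f-inj {u = u} {v} su sv gu≡gv = f-inj (+-cancelˡ-≡ (g v) (f u) (f v)
      (trans (cong (_+ f u) (sym gu≡gv)) (trans (gSet-complement su) (sym (gSet-complement sv)))))

    gSet-injective : Injective _≡_ _≡_ f → SetOrdered g → Injective _≡_ _≡_ g
    gSet-injective f-inj g-ordered {u} {v} gu≡gv with side u Bool.≟ side v
    ... | yes su≡sv = gSet-injective-onSide f-inj su≡sv refl gu≡gv
    ... | no  su≢sv = contradiction gu≡gv (≢-across g-ordered su≢sv)

    edgeLab-gSet-sum : SetOrdered f → ∀ e →
      edgeLab G g e + edgeLab G f e + (maxOn true f + minOn true f) ≡ maxOn false f + minOn false f
    edgeLab-gSet-sum ordered e = begin
      edgeLab G g e + edgeLab G f e + (maxOn true f + minOn true f)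
        ≡⟨ cong₂ (λ d d′ → d + d′ + _) (edgeLab≡∸ g-ordered e) (edgeLab≡∸ ordered e) ⟩
      (g y ∸ g x) + (f y ∸ f x) + (maxOn true f + minOn true f)
        ≡⟨ cong ((g y ∸ g x) + (f y ∸ f x) +_) (gSet-complement (endX e)) ⟨
      (g y ∸ g x) + (f y ∸ f x) + (g x + f x)
        ≡⟨ differences-sum (<⇒≤ (<-across g-ordered (endX e) (endY e)))
                           (<⇒≤ (<-across ordered (endX e) (endY e))) ⟩
      g y + f y
        ≡⟨ gSet-complement (endY e) ⟩
      maxOn false f + minOn false f ∎
      where open ≡-Reasoning
            x y : Fin p
            x = xe G e
            y = ye G e
            g-ordered : SetOrdered g
            g-ordered = gSet-setOrdered (endX e) (endY e) ordered

  gSet-involutive : ∀ f v → gSet G (gSet G f) v ≡ f v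
  gSet-involutive f v = begin
    gSet G g v                          ≡⟨ gSet-onSide refl ⟩
    maxOn s g + minOn s g ∸ g v         ≡⟨ cong₂ (λ M m → M + m ∸ g v) (maxOn-gSet refl) (minOn-gSet refl) ⟩
    maxOn s f + minOn s f ∸ g v         ≡⟨ cong (_∸ g v) (gSet-complement refl) ⟨
    g v + f v ∸ g v                     ≡⟨ m+n∸m≡n (g v) (f v) ⟩
    f v                                 ∎
    where open ≡-Reasoning
          g : Fin p → ℕ
          g = gSet G f
          s : Bool
          s = side v

  IsSOGraceful-resp-≗ : ∀ {f h} → (∀ v → f v ≡ h v) → IsSOGraceful G f → IsSOGraceful G h
  IsSOGraceful-resp-≗ {f} {h} f≗h (f-inj , f≤q , (z , fz≡0) , range , onto , ordered) =
      (λ {u} {v} hu≡hv → f-inj (trans (f≗h u) (trans hu≡hv (sym (f≗h v)))))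
    , (λ v → subst (_≤ q) (f≗h v) (f≤q v))
    , (z , trans (sym (f≗h z)) fz≡0)
    , (λ e → subst (λ d → 1 ≤ d × d ≤ q) (labels e) (range e))
    , (λ k 1≤k k≤q → let (e , fe≡k) = onto k 1≤k k≤q in e , trans (sym (labels e)) fe≡k)
    , subst₂ (λ xs ys → maxL xs < minL ys) (map-cong f≗h (onSide true)) (map-cong f≗h (onSide false)) ordered
    where
    labels : ∀ e → edgeLab G f e ≡ edgeLab G h e
    labels e = cong₂ ℕ.∣_-_∣ (f≗h _) (f≗h _)

  module _ {f : Fin p → ℕ} (1≤q : 1 ≤ q) (graceful : IsSOGraceful G f) where
    private
      f-inj : Injective _≡_ _≡_ f
      f-inj = proj₁ graceful
      f≤q : ∀ v → f v ≤ q
      f≤q = proj₁ (proj₂ graceful)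
      z : Fin p
      z = proj₁ (proj₁ (proj₂ (proj₂ graceful)))
      fz≡0 : f z ≡ 0
      fz≡0 = proj₂ (proj₁ (proj₂ (proj₂ graceful)))
      range : ∀ e → 1 ≤ edgeLab G f e × edgeLab G f e ≤ q
      range = proj₁ (proj₂ (proj₂ (proj₂ graceful)))
      onto : ∀ k → 1 ≤ k → k ≤ q → ∃[ e ] edgeLab G f e ≡ k
      onto = proj₁ (proj₂ (proj₂ (proj₂ (proj₂ graceful))))
      ordered : SetOrdered f
      ordered = proj₂ (proj₂ (proj₂ (proj₂ (proj₂ graceful))))

      g : Fin p → ℕ
      g = gSet G f

      g-ordered : SetOrdered g
      g-ordered = gSet-setOrdered (endX (fromℕ< 1≤q)) (endY (fromℕ< 1≤q)) ordered

      edge-of : ∀ k → 1 ≤ k → k ≤ q → ∃[ e ] f (ye G e) ∸ f (xe G e) ≡ k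
      edge-of k 1≤k k≤q with onto k 1≤k k≤q
      ... | e , fe≡k = e , trans (sym (edgeLab≡∸ ordered e)) fe≡k

    graceful-minOn-X : minOn true f ≡ 0
    graceful-minOn-X with side z in sz
    ... | true  = n≤0⇒n≡0 (≤-trans (minOn-lower sz) (≤-reflexive fz≡0))
    ... | false = contradiction (<-≤-trans ordered (≤-trans (minOn-lower sz) (≤-reflexive fz≡0))) n≮0

    graceful-minOn-Y : minOn false f ≡ suc (maxOn true f)
    graceful-minOn-Y with edge-of 1 ≤-refl 1≤q
    ... | e , d≡1 = ≤-antisym (begin
      minOn false f                    ≤⟨ minOn-lower (endY e) ⟩
      f (ye G e)                       ≡⟨ m∸n+n≡m (<⇒≤ (<-across ordered (endX e) (endY e))) ⟨
      f (ye G e) ∸ f (xe G e) + f (xe G e)  ≡⟨ cong (_+ f (xe G e)) d≡1 ⟩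
      suc (f (xe G e))                 ≤⟨ ℕ.s≤s (maxOn-upper (endX e)) ⟩
      suc (maxOn true f)               ∎) ordered
      where open ≤-Reasoning

    graceful-maxOn-Y : maxOn false f ≡ q
    graceful-maxOn-Y with edge-of q 1≤q ≤-refl
    ... | e , d≡q = maxOn-unique (λ u _ → f≤q u) (endY e)
      (≤-antisym (f≤q (ye G e)) (≤-trans (≤-reflexive (sym d≡q)) (m∸n≤m (f (ye G e)) (f (xe G e)))))

    graceful-edge-extremes : maxL (valsE G f) + minL (valsE G f) ≡ suc q
    graceful-edge-extremes = trans
      (cong₂ _+_ (maxL-unique (labelsAll (proj₂ ∘ range)) (labelled q 1≤q ≤-refl))
                 (minL-unique (labelsAll (proj₁ ∘ range)) (labelled 1 ≤-refl 1≤q)))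
      (+-comm q 1)
      where
      labelsAll : ∀ {P : ℕ → Set} → (∀ e → P (edgeLab G f e)) → All P (valsE G f)
      labelsAll P-lab = map⁺ (tabulate⁺ P-lab)
      labelled : ∀ k → 1 ≤ k → k ≤ q → k ∈ valsE G f
      labelled k 1≤k k≤q with onto k 1≤k k≤q
      ... | e , fe≡k = subst (_∈ valsE G f) fe≡k (∈-map⁺ (edgeLab G f) (∈-allFin e))

    edgeLab-gSet-graceful : ∀ e → edgeLab G g e + edgeLab G f e ≡ suc q
    edgeLab-gSet-graceful e = +-cancelʳ-≡ A L (suc q) (begin
      L + A                          ≡⟨ cong (L +_) (+-identityʳ A) ⟨
      L + (A + 0)                    ≡⟨ cong (λ m → L + (A + m)) graceful-minOn-X ⟨
      L + (A + minOn true f)         ≡⟨ edgeLab-gSet-sum ordered e ⟩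
      maxOn false f + minOn false f  ≡⟨ cong₂ _+_ graceful-maxOn-Y graceful-minOn-Y ⟩
      q + suc A                      ≡⟨ +-suc q A ⟩
      suc q + A                      ∎)
      where open ≡-Reasoning
            A L : ℕ
            A = maxOn true f
            L = edgeLab G g e + edgeLab G f e

    edgeLab-gSet≡ : ∀ e → edgeLab G g e ≡ suc q ∸ edgeLab G f e
    edgeLab-gSet≡ e = trans (sym (m+n∸n≡m (edgeLab G g e) (edgeLab G f e)))
                            (cong (_∸ edgeLab G f e) (edgeLab-gSet-graceful e))

    gSet-graceful : IsSOGraceful G g
    gSet-graceful = gSet-injective f-inj g-ordered , g≤q , g-zero , g-range , g-onto , g-ordered
      where
      g≤q : ∀ v → g v ≤ q
      g≤q v with maxOn-attained {h = f} {v = v} refl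
      ... | w , _ , fw≡max = ≤-trans (gSet-upper refl) (subst (_≤ q) fw≡max (f≤q w))
      g-zero : ∃[ v ] g v ≡ 0
      g-zero with minOn-attained {h = g} (endX (fromℕ< 1≤q))
      ... | w , _ , gw≡min = w , trans gw≡min (trans (minOn-gSet (endX (fromℕ< 1≤q))) graceful-minOn-X)
      g-range : ∀ e → 1 ≤ edgeLab G g e × edgeLab G g e ≤ q
      g-range e = subst (λ d → 1 ≤ d × d ≤ q) (sym (edgeLab-gSet≡ e))
                        (reflect-[1,q] (proj₁ (range e)) (proj₂ (range e)))
      g-onto : ∀ k → 1 ≤ k → k ≤ q → ∃[ e ] edgeLab G g e ≡ k
      g-onto k 1≤k k≤q with onto (suc q ∸ k) (proj₁ (reflect-[1,q] 1≤k k≤q)) (proj₂ (reflect-[1,q] 1≤k k≤q))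
      ... | e , fe≡q+1-k = e , trans (edgeLab-gSet≡ e)
                                 (trans (cong (suc q ∸_) fe≡q+1-k) (m∸[m∸n]≡n (m≤n⇒m≤1+n k≤q)))

    gStarE≡edgeLab-gSet : ∀ e → gStarE G f e ≡ ℤ.+ edgeLab G g e
    gStarE≡edgeLab-gSet e = begin
      ℤ.+ (maxL (valsE G f) + minL (valsE G f)) ℤ.- ℤ.+ edgeLab G f e
        ≡⟨ cong (λ n → ℤ.+ n ℤ.- ℤ.+ edgeLab G f e) (trans graceful-edge-extremes (sym (edgeLab-gSet-graceful e))) ⟩
      ℤ.+ (edgeLab G g e + edgeLab G f e) ℤ.- ℤ.+ edgeLab G f e
        ≡⟨ +[m+n]-+n≡+m (edgeLab G g e) (edgeLab G f e) ⟩
      ℤ.+ edgeLab G g e ∎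
      where open ≡-Reasoning

    gStar-graceful-difference : IsSOGDTL G (gStarV G f) (gStarE G f)
    gStar-graceful-difference =
        proj₁ gSet-graceful ∘ ℤ.+-injective
      , (λ x y sx sy → ℤ.+<+ (<-across g-ordered sx sy))
      , 0 , defect-zero
      where
      defect-zero : ∀ e → ℤ.∣ ℤ.+ ℤ.∣ gStarV G f (xe G e) ℤ.- gStarV G f (ye G e) ∣ ℤ.- gStarE G f e ∣ ≡ 0
      defect-zero e = begin
        ℤ.∣ ℤ.+ ℤ.∣ ℤ.+ g (xe G e) ℤ.- ℤ.+ g (ye G e) ∣ ℤ.- gStarE G f e ∣
          ≡⟨ cong₂ (λ n i → ℤ.∣ ℤ.+ n ℤ.- i ∣) vertex-difference (gStarE≡edgeLab-gSet e) ⟩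
        ℤ.∣ ℤ.+ edgeLab G g e ℤ.- ℤ.+ edgeLab G g e ∣
          ≡⟨ cong ℤ.∣_∣ (ℤ.+-inverseʳ (ℤ.+ edgeLab G g e)) ⟩
        0 ∎
        where open ≡-Reasoning
              vertex-difference : ℤ.∣ ℤ.+ g (xe G e) ℤ.- ℤ.+ g (ye G e) ∣ ≡ edgeLab G g e
              vertex-difference = trans (∣+m-+n∣≡n∸m (<⇒≤ (<-across g-ordered (endX e) (endY e))))
                                        (sym (edgeLab≡∸ g-ordered e))

mainTheorem2 : ∀ {p q : ℕ} (G : BipGraph p q) → Connected G → 1 ≤ q → (f : Fin p → ℕ)
    → IsSOGraceful G f ⇔ (IsSOGraceful G (gSet G f) × IsSOGDTL G (gStarV G f) (gStarE G f))
mainTheorem2 G _ 1≤q f = mk⇔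
  (λ graceful → gSet-graceful G 1≤q graceful , gStar-graceful-difference G 1≤q graceful)
  (λ (g-graceful , _) →
    IsSOGraceful-resp-≗ G (gSet-involutive G f) (gSet-graceful G 1≤q g-graceful))
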